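{- Let $n\ge 1$ and let $F:\{0,1\}^n\to\{0,1\}^n$ be an automata network of degree at most $2$. If $\mathrm{rk}(F)<2^n$, then $\mathrm{rk}(F)\le 2^n-2^{n-2}$.
   Context: An automata network is a map $F:\{0,1\}^V\to\{0,1\}^V$, $V=\{1,\dots,n\}$, with local functions $f_j(x)=F(x)_j$. Its interaction graph has an arc $(i,j)$ iff $f_j$ effectively depends on $x_i$ (there exist $x,x'$ differing only at $i$ with $f_j(x)\neq f_j(x')$). The degree of $F$ is the maximum in-degree of its interaction graph. The rank $\mathrm{rk}(F)$ is $|F(\{0,1\}^n)|$. -}

module Defs where

open import Data.Nat using (ℕ; zero; suc)
open import Data.Bool using (Bool; true; false; not)
open import Data.Bool.Properties using () renaming (_≟_ to _≟B_)
open import Data.Fin using (Fin)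
open import Data.Vec using (Vec; []; _∷_; lookup; _[_]%=_)
open import Data.Vec.Properties using (≡-dec)
open import Data.List using (List; []; _∷_; map; concatMap; filter; length)
open import Data.List.Relation.Unary.Any using (any?)
open import Data.Product using (∃; _×_)
open import Relation.Binary.PropositionalEquality using (_≡_; _≢_)
open import Relation.Nullary using (¬_)

-- configurations {0,1}^n, with 0 = false, 1 = true
Config : ℕ → Set
Config n = Vec Bool n

AN : ℕ → Set
AN n = Config n → Config n

local : ∀ {n} → AN n → Fin n → Config n → Bool
local F j x = lookup (F x) j

flipAt : ∀ {n} → Config n → Fin n → Config n
flipAt x i = x [ i ]%= not

-- arc (i,j) of the interaction graph: f_j effectively depends on x_i
-- (configurations differing only at i are exactly x and flipAt x i)
Arc : ∀ {n} → AN n → Fin n → Fin n → Set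
Arc F i j = ∃ λ x → local F j x ≢ local F j (flipAt x i)

-- degree at most 2: every vertex j has in-degree ≤ 2, i.e. there are
-- no three pairwise distinct in-neighbours of j
DegreeAtMost2 : ∀ {n} → AN n → Set
DegreeAtMost2 {n} F = (j i₁ i₂ i₃ : Fin n) →
  i₁ ≢ i₂ → i₁ ≢ i₃ → i₂ ≢ i₃ →
  ¬ (Arc F i₁ j × Arc F i₂ j × Arc F i₃ j)

allConfigs : (n : ℕ) → List (Config n)
allConfigs zero = [] ∷ []
allConfigs (suc n) = concatMap (λ x → (false ∷ x) ∷ (true ∷ x) ∷ []) (allConfigs n)

_≟C_ : ∀ {n} → (x y : Config n) → Relation.Nullary.Dec (x ≡ y)
_≟C_ = ≡-dec _≟B_

rank : ∀ {n} → AN n → ℕ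
rank {n} F = length (filter (λ y → any? (λ x → F x ≟C y) (allConfigs n)) (allConfigs n))

-- A local function of degree ≤ 2 depends on at most two coordinates x_i, x_k, and every
-- Boolean function of two variables is either affine over GF(2) or takes some value v at
-- exactly one point (p, q).  In the second case every image F(x) either has F(x)_j ≠ v,
-- or comes from an x with x_i = p and x_k = q: at most 2^(n-1) + 2^(n-2) configurations.
-- If all local functions are affine then so is F, and a non-injective affine F is
-- invariant under translation by x ⊕ y for a collision F x ≡ F y, so its image is
-- already covered by the half-cube {z_i = 0}, where x_i ≠ y_i.
module Submission where

open import Defs
open import Data.Nat using (ℕ; zero; suc; _≤_; _<_; _^_; _∸_; _≥_; _+_; _*_; z≤n; s≤s)
open import Data.Nat.Properties
  using (≤-pred; <⇒≱; ≤-trans; m≤m+n; m+n∸n≡m; *-suc; suc-injective)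
open import Data.Nat.Tactic.RingSolver using (solve-∀)
open import Data.Bool using (Bool; true; false; not; _xor_)
open import Data.Bool.Properties
  using (¬-not; xor-same; xor-assoc; xor-identityʳ; xor-inverseˡ) renaming (_≟_ to _≟B_)
open import Data.Maybe using (Maybe; just; nothing)
open import Data.Fin using (Fin; zero; suc; punchIn) renaming (_≟_ to _≟F_)
open import Data.Fin.Properties using (punchInᵢ≢i)
open import Data.Vec using (Vec; []; _∷_; lookup; replicate; zipWith; tail; _[_]≔_)
open import Data.Vec.Properties
  using (∷-injectiveʳ; lookup∘update; lookup∘update′; lookup-replicate; lookup-zipWith;
         tabulate∘lookup; tabulate-cong)
open import Data.List using (List; []; _∷_; map; concatMap; filter; length; _++_)
open import Data.List.Properties using (length-map; length-++; length-removeAt′)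
open import Data.List.Membership.Propositional using (_∈_; _─_)
open import Data.List.Membership.Propositional.Properties
  using (∈-map⁺; ∈-map⁻; ∈-filter⁺; ∈-filter⁻; ∈-++⁺ˡ; ∈-++⁺ʳ)
open import Data.List.Relation.Binary.Subset.Propositional using (_⊆_)
open import Data.List.Relation.Unary.Any as Any using (Any; here; there; any?; satisfied)
open import Data.List.Relation.Unary.All as All using ([]; _∷_)
open import Data.List.Relation.Unary.Unique.Propositional using (Unique; []; _∷_)
import Data.List.Relation.Unary.Unique.Propositional.Properties as Unique
open import Data.Product using (∃; ∃₂; Σ-syntax; _×_; _,_)
open import Data.Sum using (_⊎_; inj₁; inj₂; [_,_]; [_,_]′)
open import Data.Empty using (⊥-elim)
open import Data.Unit using (tt)
open import Function using (_∘_; id)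
open import Function.Definitions using (Injective)
open import Relation.Binary.PropositionalEquality
  using (_≡_; _≢_; refl; sym; trans; cong; cong₂; subst; module ≡-Reasoning)
open import Relation.Nullary using (¬_; Dec; yes; no; contradiction)
open import Relation.Nullary.Decidable using (toWitness; toSum; map′; _×-dec_; _⊎-dec_; _→-dec_)

open ≡-Reasoning

private
  variable
    m n : ℕ

∀⊎∃-Fin : {A B : Fin n → Set} → (∀ i → A i ⊎ B i) → (∀ i → A i) ⊎ ∃ B
∀⊎∃-Fin {zero}  d = inj₁ λ ()
∀⊎∃-Fin {suc n} d with d zero | ∀⊎∃-Fin (d ∘ suc)
... | inj₂ b | _            = inj₂ (zero , b)
... | inj₁ _ | inj₂ (i , b) = inj₂ (suc i , b)
... | inj₁ a | inj₁ as      = inj₁ λ { zero → a ; (suc i) → as i }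

∀⊎∃-Config : {A B : Config n → Set} → (∀ x → A x ⊎ B x) → (∀ x → A x) ⊎ ∃ B
∀⊎∃-Config {zero} d with d []
... | inj₁ a = inj₁ λ { [] → a }
... | inj₂ b = inj₂ ([] , b)
∀⊎∃-Config {suc n} d with ∀⊎∃-Config (d ∘ (false ∷_)) | ∀⊎∃-Config (d ∘ (true ∷_))
... | inj₂ (x , b) | _            = inj₂ (false ∷ x , b)
... | inj₁ _       | inj₂ (x , b) = inj₂ (true ∷ x , b)
... | inj₁ a₀      | inj₁ a₁      = inj₁ λ { (false ∷ x) → a₀ x ; (true ∷ x) → a₁ x }

∀-Bool? : {P : Bool → Set} → (∀ b → Dec (P b)) → Dec (∀ b → P b)
∀-Bool? P? = map′ (λ { (p , q) false → p ; (p , q) true → q }) (λ f → f false , f true)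
                  (P? false ×-dec P? true)

∃-Bool? : {P : Bool → Set} → (∀ b → Dec (P b)) → Dec (∃ P)
∃-Bool? P? = map′ [ (false ,_) , (true ,_) ] (λ { (false , p) → inj₁ p ; (true , p) → inj₂ p })
                  (P? false ⊎-dec P? true)

_⊕_ : Config n → Config n → Config n
_⊕_ = zipWith _xor_

𝟎 : Config n
𝟎 = replicate _ false

lookup-ext : {u v : Config n} → (∀ i → lookup u i ≡ lookup v i) → u ≡ v
lookup-ext {u = u} {v} eq = trans (sym (tabulate∘lookup u)) (trans (tabulate-cong eq) (tabulate∘lookup v))

≢⇒lookup-≢ : {u v : Config n} → u ≢ v → ∃ λ i → lookup u i ≢ lookup v i
≢⇒lookup-≢ {u = u} {v} u≢v with ∀⊎∃-Fin (λ i → toSum (lookup u i ≟B lookup v i))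
... | inj₁ same = contradiction (lookup-ext same) u≢v
... | inj₂ diff = diff

xor-≢ : {a b : Bool} → a ≢ b → a xor b ≡ true
xor-≢ {a} {b} a≢b = trans (cong (_xor b) (¬-not a≢b)) (xor-inverseˡ b)

injective⊎collision : (F : Config n → Config m) →
  Injective _≡_ _≡_ F ⊎ ∃₂ λ x y → x ≢ y × F x ≡ F y
injective⊎collision F with ∀⊎∃-Config (λ x → ∀⊎∃-Config (collision? x))
  where
  collision? : ∀ x y → (F x ≡ F y → x ≡ y) ⊎ (x ≢ y × F x ≡ F y)
  collision? x y with x ≟C y | F x ≟C F y
  ... | yes x≡y | _         = inj₁ λ _ → x≡y
  ... | no x≢y  | yes Fx≡Fy = inj₂ (x≢y , Fx≡Fy)
  ... | no _    | no Fx≢Fy  = inj₁ (⊥-elim ∘ Fx≢Fy)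
... | inj₁ inj       = inj₁ λ {x} {y} → inj x y
... | inj₂ collision = inj₂ collision

module _ {A : Set} where

  ∈-─ : {x y : A} {xs : List A} (x∈xs : x ∈ xs) → y ∈ xs → y ≢ x → y ∈ xs ─ x∈xs
  ∈-─ (here refl)  (here refl)  y≢x = contradiction refl y≢x
  ∈-─ (here refl)  (there y∈xs) _   = y∈xs
  ∈-─ (there _)    (here refl)  _   = here refl
  ∈-─ (there x∈xs) (there y∈xs) y≢x = there (∈-─ x∈xs y∈xs y≢x)

  Unique-⊆⇒length≤ : {xs ys : List A} → Unique xs → xs ⊆ ys → length xs ≤ length ys
  Unique-⊆⇒length≤ {[]}     _           _  = z≤n
  Unique-⊆⇒length≤ {x ∷ xs} {ys} (x∉xs ∷ u) xs⊆ys =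
    subst (suc (length xs) ≤_) (sym (length-removeAt′ ys _))
      (s≤s (Unique-⊆⇒length≤ u λ y∈xs → ∈-─ x∈ys (xs⊆ys (there y∈xs)) (All.lookup x∉xs y∈xs ∘ sym)))
    where
    x∈ys : x ∈ ys
    x∈ys = xs⊆ys (here refl)

-- Subcubes of configurations with some coordinates prescribed

Pattern : ℕ → Set
Pattern n = Vec (Maybe Bool) n

data Matches : Pattern n → Config n → Set where
  []        : Matches [] []
  unpinned∷ : {c : Pattern n} {x : Config n} (b : Bool) → Matches c x → Matches (nothing ∷ c) (b ∷ x)
  pinned∷   : {c : Pattern n} {x : Config n} {b : Bool} → Matches c x → Matches (just b ∷ c) (b ∷ x)

free : Pattern n → ℕ
free []            = 0
free (nothing ∷ c) = suc (free c)
free (just _ ∷ c)  = free c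

double : List (Config n) → List (Config (suc n))
double = concatMap (λ x → (false ∷ x) ∷ (true ∷ x) ∷ [])

cube : Pattern n → List (Config n)
cube []            = [] ∷ []
cube (nothing ∷ c) = double (cube c)
cube (just b ∷ c)  = map (b ∷_) (cube c)

length-double : (xs : List (Config n)) → length (double xs) ≡ 2 * length xs
length-double []       = refl
length-double (x ∷ xs) = trans (cong (2 +_) (length-double xs)) (sym (*-suc 2 (length xs)))

∈-double : {x : Config n} {xs : List (Config n)} (b : Bool) → x ∈ xs → (b ∷ x) ∈ double xs
∈-double false (here refl) = here refl
∈-double true  (here refl) = there (here refl)
∈-double b     (there x∈xs) = there (there (∈-double b x∈xs))

∈-double⁻ : {y : Config (suc n)} (xs : List (Config n)) → y ∈ double xs → tail y ∈ xs
∈-double⁻ (x ∷ xs) (here refl)         = here refl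
∈-double⁻ (x ∷ xs) (there (here refl)) = here refl
∈-double⁻ (x ∷ xs) (there (there y∈))  = there (∈-double⁻ xs y∈)

Unique-double : {xs : List (Config n)} → Unique xs → Unique (double xs)
Unique-double {xs = []}     []         = []
Unique-double {xs = x ∷ xs} (x∉xs ∷ u) =
  All.tabulate (λ { (here refl) () ; (there y∈) → distinct y∈ })
  ∷ All.tabulate distinct ∷ Unique-double u
  where
  distinct : ∀ {b y} → y ∈ double xs → b ∷ x ≢ y
  distinct y∈ eq = All.lookup x∉xs (∈-double⁻ xs y∈) (cong tail eq)

length-cube : (c : Pattern n) → length (cube c) ≡ 2 ^ free c
length-cube []            = refl
length-cube (nothing ∷ c) = trans (length-double (cube c)) (cong (2 *_) (length-cube c))
length-cube (just b ∷ c)  = trans (length-map (b ∷_) (cube c)) (length-cube c)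

Unique-cube : (c : Pattern n) → Unique (cube c)
Unique-cube []            = [] ∷ []
Unique-cube (nothing ∷ c) = Unique-double (Unique-cube c)
Unique-cube (just b ∷ c)  = Unique.map⁺ ∷-injectiveʳ (Unique-cube c)

cube-complete : {c : Pattern n} {x : Config n} → Matches c x → x ∈ cube c
cube-complete []                  = here refl
cube-complete (unpinned∷ b m)     = ∈-double b (cube-complete m)
cube-complete (pinned∷ {b = b} m) = ∈-map⁺ (b ∷_) (cube-complete m)

blank : (n : ℕ) → Pattern n
blank n = replicate n nothing

Matches-blank : (x : Config n) → Matches (blank n) x
Matches-blank []      = []
Matches-blank (b ∷ x) = unpinned∷ b (Matches-blank x)

Matches-set : {c : Pattern n} {x : Config n} (i : Fin n) {b : Bool} →
  Matches c x → lookup x i ≡ b → Matches (c [ i ]≔ just b) x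
Matches-set zero    (unpinned∷ b m) refl = pinned∷ m
Matches-set zero    (pinned∷ m)     refl = pinned∷ m
Matches-set (suc i) (unpinned∷ b m) e    = unpinned∷ b (Matches-set i m e)
Matches-set (suc i) (pinned∷ m)     e    = pinned∷ (Matches-set i m e)

free-blank : (n : ℕ) → free (blank n) ≡ n
free-blank zero    = refl
free-blank (suc n) = cong suc (free-blank n)

free-set : (c : Pattern n) (i : Fin n) {b : Bool} → lookup c i ≡ nothing →
  suc (free (c [ i ]≔ just b)) ≡ free c
free-set (nothing ∷ c) zero    _ = refl
free-set (nothing ∷ c) (suc i) e = cong suc (free-set c i e)
free-set (just _ ∷ c)  (suc i) e = free-set c i e

allConfigs≡cube-blank : (n : ℕ) → allConfigs n ≡ cube (blank n)
allConfigs≡cube-blank zero    = refl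
allConfigs≡cube-blank (suc n) = cong double (allConfigs≡cube-blank n)

∈-allConfigs : (x : Config n) → x ∈ allConfigs n
∈-allConfigs {n} x = subst (x ∈_) (sym (allConfigs≡cube-blank n)) (cube-complete (Matches-blank x))

Unique-allConfigs : (n : ℕ) → Unique (allConfigs n)
Unique-allConfigs n = subst Unique (sym (allConfigs≡cube-blank n)) (Unique-cube (blank n))

length-allConfigs : (n : ℕ) → length (allConfigs n) ≡ 2 ^ n
length-allConfigs n = begin
  length (allConfigs n)   ≡⟨ cong length (allConfigs≡cube-blank n) ⟩
  length (cube (blank n)) ≡⟨ length-cube (blank n) ⟩
  2 ^ free (blank n)      ≡⟨ cong (2 ^_) (free-blank n) ⟩
  2 ^ n                   ∎

pin : Fin n → Bool → Pattern n
pin i b = blank _ [ i ]≔ just b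

pin₂ : Fin n → Bool → Fin n → Bool → Pattern n
pin₂ i p k q = pin i p [ k ]≔ just q

Matches-pin : {x : Config n} (i : Fin n) {b : Bool} → lookup x i ≡ b → Matches (pin i b) x
Matches-pin {x = x} i = Matches-set i (Matches-blank x)

Matches-pin₂ : {x : Config n} (i k : Fin n) {p q : Bool} →
  lookup x i ≡ p → lookup x k ≡ q → Matches (pin₂ i p k q) x
Matches-pin₂ i k xᵢ≡p xₖ≡q = Matches-set k (Matches-pin i xᵢ≡p) xₖ≡q

free-pin : (i : Fin n) (b : Bool) → suc (free (pin i b)) ≡ n
free-pin {n} i b = trans (free-set (blank n) i (lookup-replicate i nothing)) (free-blank n)

length-cube-pin : (i : Fin (suc n)) (b : Bool) → length (cube (pin i b)) ≡ 2 ^ n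
length-cube-pin i b = trans (length-cube (pin i b)) (cong (2 ^_) (suc-injective (free-pin i b)))

length-cube-pin₂ : {i k : Fin (suc (suc n))} → i ≢ k → (p q : Bool) →
  length (cube (pin₂ i p k q)) ≡ 2 ^ n
length-cube-pin₂ {n} {i} {k} i≢k p q =
  trans (length-cube (pin₂ i p k q)) (cong (2 ^_) (suc-injective (suc-injective free≡)))
  where
  pinₖ≡nothing : lookup (pin i p) k ≡ nothing
  pinₖ≡nothing = trans (lookup∘update′ (i≢k ∘ sym) (blank _) _) (lookup-replicate k nothing)
  free≡ : suc (suc (free (pin₂ i p k q))) ≡ suc (suc n)
  free≡ = trans (cong suc (free-set (pin i p) k pinₖ≡nothing)) (free-pin i p)

inImage? : (F : AN n) (y : Config n) → Dec (Any (λ x → F x ≡ y) (allConfigs n))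
inImage? F y = any? (λ x → F x ≟C y) (allConfigs _)

rank-≤ : (F : AN n) (ys : List (Config n)) → (∀ x → F x ∈ ys) → rank F ≤ length ys
rank-≤ {n} F ys covered =
  Unique-⊆⇒length≤ (Unique.filter⁺ (inImage? F) (Unique-allConfigs n)) λ y∈image →
    let (_ , x↦y) = ∈-filter⁻ (inImage? F) {xs = allConfigs n} y∈image
        (x , Fx≡y) = satisfied x↦y
    in subst (_∈ ys) Fx≡y (covered x)

injective⇒rank≥ : (F : AN n) → Injective _≡_ _≡_ F → 2 ^ n ≤ rank F
injective⇒rank≥ {n} F inj =
  subst (_≤ rank F) (trans (length-map F (allConfigs n)) (length-allConfigs n))
    (Unique-⊆⇒length≤ (Unique.map⁺ inj (Unique-allConfigs n)) image⊆)
  where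
  image⊆ : map F (allConfigs n) ⊆ filter (inImage? F) (allConfigs n)
  image⊆ y∈ with ∈-map⁻ F y∈
  ... | x , x∈ , refl = ∈-filter⁺ (inImage? F) (∈-allConfigs (F x)) (Any.map (cong F ∘ sym) x∈)

-- Boolean functions of two variables

table : Bool → Bool → Bool → Bool → Bool → Bool → Bool
table t₀₀ t₀₁ t₁₀ t₁₁ false false = t₀₀
table t₀₀ t₀₁ t₁₀ t₁₁ false true  = t₀₁
table t₀₀ t₀₁ t₁₀ t₁₁ true  false = t₁₀
table t₀₀ t₀₁ t₁₀ t₁₁ true  true  = t₁₁

table-of : (g : Bool → Bool → Bool) (a b : Bool) →
  g a b ≡ table (g false false) (g false true) (g true false) (g true true) a b
table-of g false false = refl
table-of g false true  = refl
table-of g true  false = refl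
table-of g true  true  = refl

Affine₂ : (Bool → Bool → Bool) → Set
Affine₂ g = ∀ a b c d → g (a xor c) (b xor d) ≡ (g a b xor g c d) xor g false false

AttainedOnlyAt : (Bool → Bool → Bool) → Bool → Bool → Bool → Set
AttainedOnlyAt g v p q = ∀ a b → g a b ≡ v → a ≡ p × b ≡ q

Classified₂ : (Bool → Bool → Bool) → Set
Classified₂ g = Affine₂ g ⊎ ∃ λ v → ∃₂ λ p q → AttainedOnlyAt g v p q

classified₂? : (g : Bool → Bool → Bool) → Dec (Classified₂ g)
classified₂? g = affine? ⊎-dec (∃-Bool? λ v → ∃-Bool? λ p → ∃-Bool? λ q → onlyAt? v p q)
  where
  affine? : Dec (Affine₂ g)
  affine? = ∀-Bool? λ a → ∀-Bool? λ b → ∀-Bool? λ c → ∀-Bool? λ d →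
    g (a xor c) (b xor d) ≟B ((g a b xor g c d) xor g false false)
  onlyAt? : ∀ v p q → Dec (AttainedOnlyAt g v p q)
  onlyAt? v p q = ∀-Bool? λ a → ∀-Bool? λ b → (g a b ≟B v) →-dec ((a ≟B p) ×-dec (b ≟B q))

every-table-classified : ∀ t₀₀ t₀₁ t₁₀ t₁₁ → Classified₂ (table t₀₀ t₀₁ t₁₀ t₁₁)
every-table-classified false false false false = toWitness {a? = classified₂? _} tt
every-table-classified false false false true  = toWitness {a? = classified₂? _} tt
every-table-classified false false true  false = toWitness {a? = classified₂? _} tt
every-table-classified false false true  true  = toWitness {a? = classified₂? _} tt
every-table-classified false true  false false = toWitness {a? = classified₂? _} tt
every-table-classified false true  false true  = toWitness {a? = classified₂? _} tt
every-table-classified false true  true  false = toWitness {a? = classified₂? _} tt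
every-table-classified false true  true  true  = toWitness {a? = classified₂? _} tt
every-table-classified true  false false false = toWitness {a? = classified₂? _} tt
every-table-classified true  false false true  = toWitness {a? = classified₂? _} tt
every-table-classified true  false true  false = toWitness {a? = classified₂? _} tt
every-table-classified true  false true  true  = toWitness {a? = classified₂? _} tt
every-table-classified true  true  false false = toWitness {a? = classified₂? _} tt
every-table-classified true  true  false true  = toWitness {a? = classified₂? _} tt
every-table-classified true  true  true  false = toWitness {a? = classified₂? _} tt
every-table-classified true  true  true  true  = toWitness {a? = classified₂? _} tt

Classified₂-resp : {g h : Bool → Bool → Bool} → (∀ a b → g a b ≡ h a b) →
  Classified₂ h → Classified₂ g
Classified₂-resp {g} {h} g≗h (inj₁ affine) = inj₁ λ a b c d → begin
  g (a xor c) (b xor d)               ≡⟨ g≗h _ _ ⟩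
  h (a xor c) (b xor d)               ≡⟨ affine a b c d ⟩
  (h a b xor h c d) xor h false false ≡⟨ cong₂ _xor_ (cong₂ _xor_ (g≗h a b) (g≗h c d)) (g≗h false false) ⟨
  (g a b xor g c d) xor g false false ∎
Classified₂-resp g≗h (inj₂ (v , p , q , onlyAt)) =
  inj₂ (v , p , q , λ a b ga≡v → onlyAt a b (trans (sym (g≗h a b)) ga≡v))

classify₂ : (g : Bool → Bool → Bool) → Classified₂ g
classify₂ g = Classified₂-resp (table-of g) (every-table-classified _ _ _ _)

-- Local functions of degree two

Irrelevant : (Config n → Bool) → Fin n → Set
Irrelevant f i = ∀ x → f x ≡ f (flipAt x i)

Relevant : (Config n → Bool) → Fin n → Set
Relevant f i = ∃ λ x → f x ≢ f (flipAt x i)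

AtMostTwoRelevant : (Config n → Bool) → Set
AtMostTwoRelevant {n} f = (i₁ i₂ i₃ : Fin n) → i₁ ≢ i₂ → i₁ ≢ i₃ → i₂ ≢ i₃ →
  ¬ (Relevant f i₁ × Relevant f i₂ × Relevant f i₃)

irrelevant⊎relevant : (f : Config n → Bool) (i : Fin n) → Irrelevant f i ⊎ Relevant f i
irrelevant⊎relevant f i = ∀⊎∃-Config λ x → toSum (f x ≟B f (flipAt x i))

relevant-besides : (f : Config n → Bool) (i l : Fin n) →
  (l ≢ i → Irrelevant f l) ⊎ (l ≢ i × Relevant f l)
relevant-besides f i l with l ≟F i | irrelevant⊎relevant f l
... | yes l≡i | _         = inj₁ λ l≢i → contradiction l≡i l≢i
... | no _    | inj₁ irr  = inj₁ λ _ → irr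
... | no l≢i  | inj₂ rel  = inj₂ (l≢i , rel)

two-relevant-cover : (f : Config (suc (suc n)) → Bool) → AtMostTwoRelevant f →
  ∃₂ λ i k → i ≢ k × (∀ l → l ≢ i → l ≢ k → Irrelevant f l)
two-relevant-cover f deg with ∀⊎∃-Fin (irrelevant⊎relevant f)
... | inj₁ irr = zero , suc zero , (λ ()) , λ l _ _ → irr l
... | inj₂ (i , relᵢ) with ∀⊎∃-Fin (relevant-besides f i)
...   | inj₁ irr = i , punchIn i zero , punchInᵢ≢i i zero ∘ sym , λ l l≢i _ → irr l l≢i
...   | inj₂ (k , k≢i , relₖ) = i , k , k≢i ∘ sym , λ l l≢i l≢k →
  [ id , (λ relₗ → contradiction (relᵢ , relₖ , relₗ) (deg i k l (k≢i ∘ sym) (l≢i ∘ sym) (l≢k ∘ sym))) ]′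
  (irrelevant⊎relevant f l)

agree-on-relevant : (f : Config n → Bool) (x y : Config n) →
  (∀ i → lookup x i ≢ lookup y i → Irrelevant f i) → f x ≡ f y
agree-on-relevant f []      []      _ = refl
agree-on-relevant f (a ∷ x) (b ∷ y) h = begin
  f (a ∷ x) ≡⟨ agree-on-relevant (f ∘ (a ∷_)) x y (λ i xᵢ≢yᵢ z → h (suc i) xᵢ≢yᵢ (a ∷ z)) ⟩
  f (a ∷ y) ≡⟨ head-agree ⟩
  f (b ∷ y) ∎
  where
  head-agree : f (a ∷ y) ≡ f (b ∷ y)
  head-agree with a ≟B b
  ... | yes refl = refl
  ... | no a≢b   = trans (h zero a≢b (a ∷ y)) (cong (λ u → f (u ∷ y)) (sym (¬-not (a≢b ∘ sym))))

-- For f depending only on x_i and x_k (i ≢ k), this is f at x_i = a, x_k = b.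
restrict₂ : (Config n → Bool) → Fin n → Bool → Bool → Bool
restrict₂ f k a b = f (replicate _ a [ k ]≔ b)

restrict₂-spec : (f : Config n → Bool) {i k : Fin n} → i ≢ k →
  (∀ l → l ≢ i → l ≢ k → Irrelevant f l) →
  ∀ x → f x ≡ restrict₂ f k (lookup x i) (lookup x k)
restrict₂-spec {n} f {i} {k} i≢k irr x = agree-on-relevant f x _ differ⇒irrelevant
  where
  differ⇒irrelevant : ∀ l → lookup x l ≢ lookup (replicate n (lookup x i) [ k ]≔ lookup x k) l →
    Irrelevant f l
  differ⇒irrelevant l xₗ≢ with l ≟F i | l ≟F k
  ... | yes refl | _        = contradiction
    (sym (trans (lookup∘update′ i≢k (replicate n _) _) (lookup-replicate l _))) xₗ≢
  ... | no _     | yes refl = contradiction (sym (lookup∘update l (replicate n _) _)) xₗ≢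
  ... | no l≢i   | no l≢k   = irr l l≢i l≢k

IsAffine : (Config n → Bool) → Set
IsAffine f = ∀ z d → f (z ⊕ d) ≡ (f z xor f d) xor f 𝟎

PinsTwo : (Config n → Bool) → Set
PinsTwo {n} f = Σ[ v ∈ Bool ] Σ[ i ∈ Fin n ] Σ[ k ∈ Fin n ] Σ[ p ∈ Bool ] Σ[ q ∈ Bool ]
  (i ≢ k × (∀ x → f x ≡ v → lookup x i ≡ p × lookup x k ≡ q))

affine⊎pinsTwo : (f : Config (suc (suc n)) → Bool) → AtMostTwoRelevant f →
  IsAffine f ⊎ PinsTwo f
affine⊎pinsTwo f deg with two-relevant-cover f deg
... | i , k , i≢k , irr with classify₂ (restrict₂ f k)
...   | inj₂ (v , p , q , onlyAt) =
  inj₂ (v , i , k , p , q , i≢k , λ x fx≡v → onlyAt _ _ (trans (sym (spec x)) fx≡v))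
  where
  spec : ∀ x → f x ≡ restrict₂ f k (lookup x i) (lookup x k)
  spec = restrict₂-spec f i≢k irr
...   | inj₁ affine = inj₁ λ z d → begin
  f (z ⊕ d)
    ≡⟨ spec (z ⊕ d) ⟩
  g (lookup (z ⊕ d) i) (lookup (z ⊕ d) k)
    ≡⟨ cong₂ g (lookup-zipWith _xor_ i z d) (lookup-zipWith _xor_ k z d) ⟩
  g (lookup z i xor lookup d i) (lookup z k xor lookup d k)
    ≡⟨ affine _ _ _ _ ⟩
  (g (lookup z i) (lookup z k) xor g (lookup d i) (lookup d k)) xor g false false
    ≡⟨ sym (cong₂ _xor_ (cong₂ _xor_ (spec z) (spec d)) (trans (spec 𝟎) g𝟎)) ⟩
  (f z xor f d) xor f 𝟎 ∎
  where
  g : Bool → Bool → Bool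
  g = restrict₂ f k
  spec : ∀ x → f x ≡ g (lookup x i) (lookup x k)
  spec = restrict₂-spec f i≢k irr
  g𝟎 : g (lookup 𝟎 i) (lookup 𝟎 k) ≡ g false false
  g𝟎 = cong₂ g (lookup-replicate i false) (lookup-replicate k false)

affine-period : {f : Config n → Bool} → IsAffine f → {x y : Config n} → f x ≡ f y →
  ∀ z → f (z ⊕ (x ⊕ y)) ≡ f z
affine-period {f = f} affine {x} {y} fx≡fy z = begin
  f (z ⊕ (x ⊕ y))             ≡⟨ affine z (x ⊕ y) ⟩
  (f z xor f (x ⊕ y)) xor f 𝟎 ≡⟨ cong (λ u → (f z xor u) xor f 𝟎) fxy≡f𝟎 ⟩
  (f z xor f 𝟎) xor f 𝟎       ≡⟨ xor-assoc (f z) (f 𝟎) (f 𝟎) ⟩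
  f z xor (f 𝟎 xor f 𝟎)       ≡⟨ cong (f z xor_) (xor-same (f 𝟎)) ⟩
  f z xor false               ≡⟨ xor-identityʳ (f z) ⟩
  f z                         ∎
  where
  fxy≡f𝟎 : f (x ⊕ y) ≡ f 𝟎
  fxy≡f𝟎 = begin
    f (x ⊕ y)             ≡⟨ affine x y ⟩
    (f x xor f y) xor f 𝟎 ≡⟨ cong (λ u → (u xor f y) xor f 𝟎) fx≡fy ⟩
    (f y xor f y) xor f 𝟎 ≡⟨ cong (_xor f 𝟎) (xor-same (f y)) ⟩
    f 𝟎                   ∎

rank-pinsTwo : (F : AN (suc (suc n))) (j : Fin (suc (suc n))) → PinsTwo (local F j) →
  rank F ≤ 2 ^ suc n + 2 ^ n
rank-pinsTwo {n} F j (v , i , k , p , q , i≢k , forces) =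
  subst (rank F ≤_) length-ys (rank-≤ F ys covered)
  where
  ys : List (Config (suc (suc n)))
  ys = cube (pin j (not v)) ++ map F (cube (pin₂ i p k q))
  covered : ∀ z → F z ∈ ys
  covered z with local F j z ≟B v
  ... | yes fz≡v = let (zᵢ≡p , zₖ≡q) = forces z fz≡v in
    ∈-++⁺ʳ (cube (pin j (not v))) (∈-map⁺ F (cube-complete (Matches-pin₂ i k zᵢ≡p zₖ≡q)))
  ... | no fz≢v = ∈-++⁺ˡ (cube-complete (Matches-pin j (¬-not fz≢v)))
  length-ys : length ys ≡ 2 ^ suc n + 2 ^ n
  length-ys = begin
    length ys
      ≡⟨ length-++ (cube (pin j (not v))) ⟩
    length (cube (pin j (not v))) + length (map F (cube (pin₂ i p k q)))
      ≡⟨ cong₂ _+_ (length-cube-pin j (not v)) (length-map F (cube (pin₂ i p k q))) ⟩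
    2 ^ suc n + length (cube (pin₂ i p k q))
      ≡⟨ cong (2 ^ suc n +_) (length-cube-pin₂ i≢k p q) ⟩
    2 ^ suc n + 2 ^ n ∎

rank-affine-collision : (F : AN (suc n)) → (∀ j → IsAffine (local F j)) →
  {x y : Config (suc n)} → x ≢ y → F x ≡ F y → rank F ≤ 2 ^ n
rank-affine-collision {n} F affine {x} {y} x≢y Fx≡Fy with ≢⇒lookup-≢ x≢y
... | i , xᵢ≢yᵢ = subst (rank F ≤_) length-ys (rank-≤ F (map F (cube (pin i false))) covered)
  where
  period : ∀ z → F (z ⊕ (x ⊕ y)) ≡ F z
  period z = lookup-ext λ j → affine-period (affine j) (cong (λ u → lookup u j) Fx≡Fy) z
  covered : ∀ z → F z ∈ map F (cube (pin i false))
  covered z with lookup z i ≟B false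
  ... | yes zᵢ≡0 = ∈-map⁺ F (cube-complete (Matches-pin i zᵢ≡0))
  ... | no zᵢ≢0  = subst (_∈ map F (cube (pin i false))) (period z)
                     (∈-map⁺ F (cube-complete (Matches-pin i shifted)))
    where
    shifted : lookup (z ⊕ (x ⊕ y)) i ≡ false
    shifted = begin
      lookup (z ⊕ (x ⊕ y)) i               ≡⟨ lookup-zipWith _xor_ i z (x ⊕ y) ⟩
      lookup z i xor lookup (x ⊕ y) i      ≡⟨ cong₂ _xor_ (¬-not zᵢ≢0) (lookup-zipWith _xor_ i x y) ⟩
      true xor (lookup x i xor lookup y i) ≡⟨ cong (true xor_) (xor-≢ xᵢ≢yᵢ) ⟩
      false                                ∎
  length-ys : length (map F (cube (pin i false))) ≡ 2 ^ n
  length-ys = trans (length-map F (cube (pin i false))) (length-cube-pin i false)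

three-quarters : (n : ℕ) → 2 ^ suc n + 2 ^ n ≡ 2 ^ suc (suc n) ∸ 2 ^ n
three-quarters n = sym (trans (cong (_∸ 2 ^ n) (split (2 ^ n))) (m+n∸n≡m (2 ^ suc n + 2 ^ n) (2 ^ n)))
  where
  split : ∀ X → 2 * (2 * X) ≡ (2 * X + X) + X
  split = solve-∀

proposition5 : (n : ℕ) → n ≥ 1 → (F : AN n) → DegreeAtMost2 F →
    rank F < 2 ^ n → rank F ≤ 2 ^ n ∸ 2 ^ (n ∸ 2)
proposition5 (suc zero)    _ F _   rank<2 = ≤-pred rank<2
proposition5 (suc (suc n)) _ F deg rank<2ⁿ = subst (rank F ≤_) (three-quarters n) bound
  where
  bound : rank F ≤ 2 ^ suc n + 2 ^ n
  bound with ∀⊎∃-Fin (λ j → affine⊎pinsTwo (local F j) (deg j))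
  ... | inj₂ (j , pins) = rank-pinsTwo F j pins
  ... | inj₁ affine with injective⊎collision F
  ...   | inj₁ inj = contradiction (injective⇒rank≥ F inj) (<⇒≱ rank<2ⁿ)
  ...   | inj₂ (x , y , x≢y , Fx≡Fy) =
    ≤-trans (rank-affine-collision F affine x≢y Fx≡Fy) (m≤m+n (2 ^ suc n) (2 ^ n))
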